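{- Let $x:\mathbb{R}_D$ be equipped with a locator. Then one can construct rationals $q,r:\mathbb{Q}$ with $q<x<r$, i.e. an element of $\sum_{q,r:\mathbb{Q}}(q<x)\times(x<r)$.
   Context: Work in Martin-Löf type theory with propositional truncation, function extensionality and propositional extensionality. A Dedekind real is a pair $x=(L,U)$ of proposition-valued predicates on $\mathbb{Q}$, writing $q<x$ for $q\in L$ and $x<r$ for $r\in U$, which is bounded ($\exists q.\,q<x$ and $\exists r.\,x<r$, truncated existence), rounded, transitive ($q<x\land x<r\Rightarrow q<r$) and located ($q<r\Rightarrow\|(q<x)+(x<r)\|$). $\mathbb{R}_D$ is the type of Dedekind reals. A locator for $x$ is a function $\prod_{q,r:\mathbb{Q}}(q<r)\to(q<x)+(x<r)$ into the untruncated disjoint sum. -}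

module Defs where

open import Level using (Level; Setω)
open import Data.Rational using (ℚ; _<_)
open import Data.Product using (Σ; _×_; _,_)
open import Data.Sum using (_⊎_)
open import Relation.Binary.PropositionalEquality using (_≡_)

isProp : ∀ {ℓ} → Set ℓ → Set ℓ
isProp A = (a b : A) → a ≡ b

-- Propositional truncation, given abstractly by its standard interface
-- (formation, introduction, being a proposition, recursion into propositions).
record PropTrunc : Setω where
  field
    ∥_∥      : ∀ {ℓ} → Set ℓ → Set ℓ
    ∣_∣      : ∀ {ℓ} {A : Set ℓ} → A → ∥ A ∥
    ∥∥-isProp : ∀ {ℓ} {A : Set ℓ} → isProp ∥ A ∥
    ∥∥-rec   : ∀ {ℓ ℓ'} {A : Set ℓ} {B : Set ℓ'} → isProp B → (A → B) → ∥ A ∥ → B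

module _ (pt : PropTrunc) where
  open PropTrunc pt

  record ℝD : Set₁ where
    field
      lower : ℚ → Set
      upper : ℚ → Set
      lower-isProp : ∀ q → isProp (lower q)
      upper-isProp : ∀ r → isProp (upper r)
      bounded-lower : ∥ Σ ℚ lower ∥
      bounded-upper : ∥ Σ ℚ upper ∥
      rounded-lower⇒ : ∀ q → lower q → ∥ Σ ℚ (λ q' → (q < q') × lower q') ∥
      rounded-lower⇐ : ∀ q → ∥ Σ ℚ (λ q' → (q < q') × lower q') ∥ → lower q
      rounded-upper⇒ : ∀ r → upper r → ∥ Σ ℚ (λ r' → (r' < r) × upper r') ∥
      rounded-upper⇐ : ∀ r → ∥ Σ ℚ (λ r' → (r' < r) × upper r') ∥ → upper r
      transitive : ∀ q r → lower q → upper r → q < r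
      located : ∀ q r → q < r → ∥ lower q ⊎ upper r ∥

  _<ℝ_ : ℚ → ℝD → Set
  q <ℝ x = ℝD.lower x q

  _ℝ<_ : ℝD → ℚ → Set
  x ℝ< r = ℝD.upper x r

  Locator : ℝD → Set
  Locator x = ∀ (q r : ℚ) → q < r → (q <ℝ x) ⊎ (x ℝ< r)

module Submission where

-- To find an
-- upper bound of x we walk up the ladder of intervals (n, n+1) and ask the
-- locator about each rung: once n exceeds some (merely existing) upper bound r
-- of x, the answer "n < x" is impossible, so the locator must answer "x < n+1".
-- The locator's answers form a decidable predicate on ℕ, and boundedness of x
-- merely tells us that it holds somewhere.  For decidable predicates on ℕ this
-- truncated existence can be turned into an actual witness: the *least* index
-- where the predicate holds is unique, so the type of least witnesses is a
-- proposition and the truncation can be eliminated into it.  Lower bounds are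
-- found symmetrically on the ladder (-(n+2), -(n+1)).

open import Defs
open import Data.Bool using (Bool; true; false; _∨_)
import Data.Bool as Bool
open import Data.Empty using (⊥-elim)
open import Data.Integer as ℤ using (ℤ; +_; -[1+_]; +≤+; -≤-; -≤+)
import Data.Integer.Properties as ℤP
open import Data.Nat as ℕ using (ℕ; zero; suc)
import Data.Nat.Properties as ℕP
open import Data.Product using (Σ; _×_; _,_; proj₁; proj₂)
open import Data.Rational using (ℚ; mkℚ; _<_; _≤_; *<*; *≤*)
open import Data.Rational.Literals using (fromℤ)
import Data.Rational.Properties as ℚP
open import Data.Sum using (_⊎_; inj₁; inj₂)
open import Axiom.UniquenessOfIdentityProofs using (module Decidable⇒UIP)
open import Relation.Binary using (tri<; tri≈; tri>)
open import Relation.Binary.PropositionalEquality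
  using (_≡_; refl; sym; trans; cong; subst; subst₂)

Bool-UIP : {b c : Bool} (p q : b ≡ c) → p ≡ q
Bool-UIP = Decidable⇒UIP.≡-irrelevant Bool._≟_

module LeastWitness (f : ℕ → Bool) where

  holdsBelow : ℕ → Bool
  holdsBelow zero    = false
  holdsBelow (suc n) = f n ∨ holdsBelow n

  IsLeast : ℕ → Set
  IsLeast n = (f n ≡ true) × (holdsBelow n ≡ false)

  fails-below : ∀ n m → holdsBelow n ≡ false → m ℕ.< n → f m ≡ false
  fails-below (suc n) m none m<1+n with f n in fn
  ... | false with ℕP.m≤n⇒m<n∨m≡n (ℕP.≤-pred m<1+n)
  ...   | inj₁ m<n  = fails-below n m none m<n
  ...   | inj₂ refl = fn

  least-below : ∀ n → holdsBelow n ≡ true → Σ ℕ IsLeast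
  least-below (suc n) some with f n in fn | holdsBelow n in below
  ... | _    | true  = least-below n below
  ... | true | false = n , fn , below

  least-isProp : isProp (Σ ℕ IsLeast)
  least-isProp (m , fm , below-m) (n , fn , below-n) with ℕP.<-cmp m n
  ... | tri< m<n _ _ with trans (sym fm) (fails-below n m below-n m<n)
  ...   | ()
  least-isProp (m , fm , below-m) (n , fn , below-n) | tri> _ _ n<m
    with trans (sym fn) (fails-below m n below-m n<m)
  ... | ()
  least-isProp (m , fm , below-m) (m , fm′ , below-m′) | tri≈ _ refl _
    rewrite Bool-UIP fm fm′ | Bool-UIP below-m below-m′ = refl

decidable-choice : (pt : PropTrunc) (f : ℕ → Bool) →
  PropTrunc.∥_∥ pt (Σ ℕ (λ n → f n ≡ true)) → Σ ℕ (λ n → f n ≡ true)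
decidable-choice pt f somewhere = n , fn
  where
  open PropTrunc pt
  open LeastWitness f
  least : Σ ℕ IsLeast
  least = ∥∥-rec least-isProp
    (λ { (k , fk) → least-below (suc k) (cong (_∨ holdsBelow k) fk) }) somewhere
  n = proj₁ least
  fn = proj₁ (proj₂ least)

fromℤ-mono-< : ∀ {i j} → i ℤ.< j → fromℤ i < fromℤ j
fromℤ-mono-< {i} {j} i<j =
  *<* (subst₂ ℤ._<_ (sym (ℤP.*-identityʳ i)) (sym (ℤP.*-identityʳ j)) i<j)

fromℤ-suc : ∀ i → fromℤ i < fromℤ (ℤ.suc i)
fromℤ-suc i = fromℤ-mono-< (ℤP.≤∧≢⇒< (ℤP.i≤suc[i] i) ℤP.i≢suc[i])

-- Archimedean property, concretely: the absolute value of the numerator of a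
-- rational bounds it from above, and its negative (minus one) from below.
≤-∣numerator∣ : ∀ r → r ≤ fromℤ (+ ℤ.∣ ℚ.numerator r ∣)
≤-∣numerator∣ (mkℚ (+ a) d _) =
  *≤* (subst₂ ℤ._≤_ (sym (ℤP.*-identityʳ (+ a))) (ℤP.pos-* a (suc d))
        (+≤+ (ℕP.m≤m*n a (suc d))))
≤-∣numerator∣ (mkℚ -[1+ a ] d _) =
  *≤* (subst (ℤ._≤ + suc (d ℕ.+ a ℕ.* suc d)) (sym (ℤP.*-identityʳ -[1+ a ])) -≤+)

-[1+∣numerator∣]-≤ : ∀ q → fromℤ -[1+ ℤ.∣ ℚ.numerator q ∣ ] ≤ q
-[1+∣numerator∣]-≤ (mkℚ (+ a) d _) =
  *≤* (subst (-[1+ d ℕ.+ a ℕ.* suc d ] ℤ.≤_) (sym (ℤP.*-identityʳ (+ a))) -≤+)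
-[1+∣numerator∣]-≤ (mkℚ -[1+ a ] d _) =
  *≤* (subst (-[1+ d ℕ.+ suc a ℕ.* suc d ] ℤ.≤_) (sym (ℤP.*-identityʳ -[1+ a ]))
        (-≤- (ℕP.≤-trans (ℕP.n≤1+n a)
               (ℕP.≤-trans (ℕP.m≤m*n (suc a) (suc d)) (ℕP.m≤n+m _ d)))))

isInj₁ : {A B : Set} → A ⊎ B → Bool
isInj₁ (inj₁ _) = true
isInj₁ (inj₂ _) = false

isInj₂ : {A B : Set} → A ⊎ B → Bool
isInj₂ (inj₁ _) = false
isInj₂ (inj₂ _) = true

fromInj₁ : {A B : Set} (s : A ⊎ B) → isInj₁ s ≡ true → A
fromInj₁ (inj₁ a) _ = a

fromInj₂ : {A B : Set} (s : A ⊎ B) → isInj₂ s ≡ true → B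
fromInj₂ (inj₂ b) _ = b

module LadderBounds (pt : PropTrunc) (x : ℝD pt) (locate : Locator pt x) where
  open PropTrunc pt
  open ℝD x

  module _ (a b : ℕ → ℚ) (a<b : ∀ n → a n < b n) where

    answer : ∀ n → (_<ℝ_ pt (a n) x) ⊎ (_ℝ<_ pt x (b n))
    answer n = locate (a n) (b n) (a<b n)

    -- If the ladder climbs above every rational, some b n is an upper bound:
    -- at a rung above an upper bound r of x the answer "a n < x" is absurd.
    upper-bound : (∀ r → Σ ℕ (λ n → r ≤ a n)) → Σ ℚ (_ℝ<_ pt x)
    upper-bound above = read-off (decidable-choice pt (λ k → isInj₂ (answer k))
      (∥∥-rec ∥∥-isProp (λ { (r , x<r) → ∣ proj₁ (above r) , forced r x<r ∣ })
        bounded-upper))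
      where
      forced : ∀ r → _ℝ<_ pt x r → isInj₂ (answer (proj₁ (above r))) ≡ true
      forced r x<r with answer (proj₁ (above r))
      ... | inj₂ _   = refl
      ... | inj₁ a<x = ⊥-elim (ℚP.<-irrefl refl
                         (ℚP.<-≤-trans (transitive _ r a<x x<r) (proj₂ (above r))))
      read-off : Σ ℕ (λ n → isInj₂ (answer n) ≡ true) → Σ ℚ (_ℝ<_ pt x)
      read-off (n , x<b) = b n , fromInj₂ (answer n) x<b

    -- Dually, if the ladder descends below every rational, some a n is a
    -- lower bound: at a rung below a lower bound q the answer "x < b n" is absurd.
    lower-bound : (∀ q → Σ ℕ (λ n → b n ≤ q)) → Σ ℚ (λ q → _<ℝ_ pt q x)
    lower-bound below = read-off (decidable-choice pt (λ k → isInj₁ (answer k))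
      (∥∥-rec ∥∥-isProp (λ { (q , q<x) → ∣ proj₁ (below q) , forced q q<x ∣ })
        bounded-lower))
      where
      forced : ∀ q → _<ℝ_ pt q x → isInj₁ (answer (proj₁ (below q))) ≡ true
      forced q q<x with answer (proj₁ (below q))
      ... | inj₁ _   = refl
      ... | inj₂ x<b = ⊥-elim (ℚP.<-irrefl refl
                         (ℚP.≤-<-trans (proj₂ (below q)) (transitive q _ q<x x<b)))
      read-off : Σ ℕ (λ n → isInj₁ (answer n) ≡ true) → Σ ℚ (λ q → _<ℝ_ pt q x)
      read-off (n , a<x) = a n , fromInj₁ (answer n) a<x

lemma3p17 : (pt : PropTrunc) (x : ℝD pt) → Locator pt x →
    Σ ℚ (λ q → Σ ℚ (λ r → (_<ℝ_ pt q x) × (_ℝ<_ pt x r)))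
lemma3p17 pt x locate = pair lower upper
  where
  open LadderBounds pt x locate
  lower : Σ ℚ (λ q → _<ℝ_ pt q x)
  lower = lower-bound (λ n → fromℤ -[1+ suc n ]) (λ n → fromℤ -[1+ n ])
            (λ n → fromℤ-suc -[1+ suc n ])
            (λ q → ℤ.∣ ℚ.numerator q ∣ , -[1+∣numerator∣]-≤ q)
  upper : Σ ℚ (_ℝ<_ pt x)
  upper = upper-bound (λ n → fromℤ (+ n)) (λ n → fromℤ (+ suc n))
            (λ n → fromℤ-suc (+ n))
            (λ r → ℤ.∣ ℚ.numerator r ∣ , ≤-∣numerator∣ r)
  pair : Σ ℚ (λ q → _<ℝ_ pt q x) → Σ ℚ (_ℝ<_ pt x) →
         Σ ℚ (λ q → Σ ℚ (λ r → (_<ℝ_ pt q x) × (_ℝ<_ pt x r)))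
  pair (q , q<x) (r , x<r) = q , r , q<x , x<r
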